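{- Let $k\ge4$, let $(p_i)_{i\ge3}$ and $(q_i)_{i\ge3}$ be sequences of positive integers with $p_i>1$ for all $3\le i\le k$, and let $j\ge1$. For every integer $n$ such that $k_j\le n<k_{j+1}$, $$\mathrm{G}_k(n)=p_k\cdot\mathrm{G}_k(n-j)+q_k\cdot\mathrm{G}_{k-1}(j).$$
   Context: $\mathrm{G}_k(n)$ is defined by $\mathrm{G}_k(0)=0$ for $k\ge3$; $\mathrm{G}_3(n)=p_3\mathrm{G}_3(n-1)+q_3$ for $n\ge1$; and $\mathrm{G}_k(n)=\min_{1\le t\le n}\{p_k\mathrm{G}_k(n-t)+q_k\mathrm{G}_{k-1}(t)\}$ for $k\ge4$, $n\ge1$. For $m\ge3$, $(u^m_l)_{l\ge1}$ is the list, in nondecreasing order and counted with multiplicity over exponent tuples $(\alpha_3,\dots,\alpha_m)\in\mathbb{Z}_{\ge0}^{m-2}$, of the numbers $\prod_{i=3}^m p_i^{\alpha_i}$. The sequence $(k_j)_{j\ge1}$ is defined by $k_1=1$ and $k_j=\min\{l>k_{j-1}\mid u^k_l=u^{k-1}_j\}$ for $j\ge2$. -}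

module Defs where

open import Data.Nat using (ℕ; zero; suc; _+_; _*_; _∸_; _^_; _≤_; _<_; _⊔_; _⊓_; _≤?_; _<?_)
open import Data.List using (List; []; _∷_; [_]; map; concatMap; filter; length; upTo)
open import Data.Vec using (Vec; []; _∷_)
open import Data.Product using (Σ; ∃; _×_; _,_)
open import Relation.Nullary using (¬_)

-- minOver n f = min { f t | 1 ≤ t ≤ n }   (only used for n ≥ 1)
minOver : ℕ → (ℕ → ℕ) → ℕ
minOver zero f = 0
minOver (suc zero) f = f 1
minOver (suc (suc n)) f = minOver (suc n) f ⊓ f (suc (suc n))

module _ (p q : ℕ → ℕ) where

  G3 : ℕ → ℕ
  G3 zero = 0
  G3 (suc n) = p 3 * G3 n + q 3

  -- Gk k prev fuel n : G_k(n) given prev = G_{k-1}, valid when n ≤ fuel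
  Gk : ℕ → (ℕ → ℕ) → ℕ → ℕ → ℕ
  Gk k prev fuel zero = 0
  Gk k prev zero (suc n) = 0
  Gk k prev (suc fuel) (suc n) =
    minOver (suc n) (λ t → p k * Gk k prev fuel (suc n ∸ t) + q k * prev t)

  -- G k n = G_k(n) for k ≥ 3 (value 0 for k < 3, never used)
  G : ℕ → ℕ → ℕ
  G zero n = 0
  G (suc zero) n = 0
  G (suc (suc zero)) n = 0
  G (suc (suc (suc zero))) n = G3 n
  G (suc (suc (suc (suc k)))) n = Gk (4 + k) (G (suc (suc (suc k)))) n n

-- The multiset { ∏_{i=3}^m p_i^{α_i} | α ∈ ℕ^{m-2} }.
-- A tuple (α_3,…,α_m) is a Vec ℕ (m ∸ 2); entry number r is α_{3+r}.

prodPow : (p : ℕ → ℕ) → (i : ℕ) → {len : ℕ} → Vec ℕ len → ℕ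
prodPow p i [] = 1
prodPow p i (a ∷ as) = p i ^ a * prodPow p (suc i) as

allVecs : (len B : ℕ) → List (Vec ℕ len)
allVecs zero B = [ [] ]
allVecs (suc len) B = concatMap (λ a → map (a ∷_) (allVecs len B)) (upTo (suc B))

-- number of exponent tuples with product ≤ x, resp. < x.
-- Enumerating entries ≤ x is exhaustive when p_i ≥ 2 for 3 ≤ i ≤ m,
-- since then α_i < p_i^{α_i} ≤ product.
countLe : (p : ℕ → ℕ) → (m x : ℕ) → ℕ
countLe p m x = length (filter (λ α → prodPow p 3 α ≤? x) (allVecs (m ∸ 2) x))

countLt : (p : ℕ → ℕ) → (m x : ℕ) → ℕ
countLt p m x = length (filter (λ α → prodPow p 3 α <? x) (allVecs (m ∸ 2) x))

-- IsU p m l x : x = u^m_l, the l-th term (l ≥ 1) of the nondecreasing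
-- enumeration, with multiplicity, of the multiset above.
IsU : (p : ℕ → ℕ) → (m l x : ℕ) → Set
IsU p m l x = countLt p m x < l × l ≤ countLe p m x

data IsK (p : ℕ → ℕ) (k : ℕ) : ℕ → ℕ → Set where
  k-one : IsK p k 1 1
  k-suc : ∀ {j a b} → IsK p k j a → a < b →
          (∃ λ w → IsU p k b w × IsU p (k ∸ 1) (suc j) w) →
          (∀ c → a < c → c < b → ¬ (∃ λ w → IsU p k c w × IsU p (k ∸ 1) (suc j) w)) →
          IsK p k (suc j) b

module Submission where

-- Write N_m(y) = #{l | u^m_l ≤ y} for the counting function of the sequence u^m.  The
-- heart of the proof is the closed form (G-closed)
--     G_m(n) = q_3 q_4 ⋯ q_m · (u^m_1 + ⋯ + u^m_n) = q_3 ⋯ q_m · Σ_{y ≥ 0} (n ∸ N_m(y)),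
-- proved by induction on m.  Splitting off the exponent of p_{m+1} gives
--     N_{m+1}(y) = N_m(y) + N_{m+1}(⌊y / p_{m+1}⌋),
-- so the candidate p_{m+1} G_{m+1}(n - t) + q_{m+1} G_m(t) in the minimum defining
-- G_{m+1}(n) is q_3⋯q_{m+1} times a sum of terms ((n - t) ∸ a_y) + (t ∸ b_y).  Termwise this
-- dominates n ∸ (a_y + b_y), with equality when t is balanced (both subtractions exact or
-- both truncated), and a balanced t always exists.  Finally k_j is identified as j plus the
-- number of terms of u^k below u^{k-1}_j that involve p_k, and for k_j ≤ n < k_{j+1} the
-- split t = j turns out to be balanced.

open import Defs
open import Data.Nat
open import Data.Nat.Properties
open import Data.Nat.ListAction using (sum)
open import Data.Nat.Tactic.RingSolver using (solve-∀)
open import Data.Bool using (true; false)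
open import Data.List using (List; []; _∷_; [_]; map; concatMap; concat; filter; length; upTo; applyUpTo; _++_)
open import Data.List.Properties using (length-++; filter-++; filter-≐)
open import Data.Vec using (Vec; []; _∷_)
open import Data.Product using (∃; _×_; _,_)
open import Data.Sum using (_⊎_; inj₁; inj₂)
open import Function using (_∋_)
open import Relation.Nullary using (¬_; Dec; yes; no; does)
open import Relation.Nullary.Negation using (contradiction)
open import Relation.Unary using (Pred; Decidable; _≐_)
open import Relation.Binary.PropositionalEquality hiding ([_])
open import Algebra.Properties.CommutativeSemigroup +-commutativeSemigroup
  using () renaming (interchange to +-interchange)
open import Algebra.Properties.CommutativeSemigroup *-commutativeSemigroup
  using () renaming (xy∙z≈xz∙y to *-swapʳ)

sumBelow : ℕ → (ℕ → ℕ) → ℕ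
sumBelow zero    f = 0
sumBelow (suc n) f = f 0 + sumBelow n (λ a → f (suc a))

sumBelow-cong : ∀ n {f g : ℕ → ℕ} → (∀ a → a < n → f a ≡ g a) → sumBelow n f ≡ sumBelow n g
sumBelow-cong zero    f≡g = refl
sumBelow-cong (suc n) f≡g =
  cong₂ _+_ (f≡g 0 z<s) (sumBelow-cong n (λ a a<n → f≡g (suc a) (s<s a<n)))

sumBelow-mono : ∀ n {f g : ℕ → ℕ} → (∀ a → a < n → f a ≤ g a) → sumBelow n f ≤ sumBelow n g
sumBelow-mono zero    f≤g = z≤n
sumBelow-mono (suc n) f≤g =
  +-mono-≤ (f≤g 0 z<s) (sumBelow-mono n (λ a a<n → f≤g (suc a) (s<s a<n)))

sumBelow-+ : ∀ n (f g : ℕ → ℕ) → sumBelow n (λ a → f a + g a) ≡ sumBelow n f + sumBelow n g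
sumBelow-+ zero    f g = refl
sumBelow-+ (suc n) f g =
  trans (cong (f 0 + g 0 +_) (sumBelow-+ n (λ a → f (suc a)) (λ a → g (suc a))))
        (+-interchange (f 0) (g 0) _ _)

sumBelow-split : ∀ m n (f : ℕ → ℕ) → sumBelow (m + n) f ≡ sumBelow m f + sumBelow n (λ a → f (m + a))
sumBelow-split zero    n f = refl
sumBelow-split (suc m) n f =
  trans (cong (f 0 +_) (sumBelow-split m n (λ a → f (suc a)))) (sym (+-assoc (f 0) _ _))

sumBelow-const : ∀ n c {f : ℕ → ℕ} → (∀ a → a < n → f a ≡ c) → sumBelow n f ≡ n * c
sumBelow-const zero    c f≡c = refl
sumBelow-const (suc n) c f≡c =
  cong₂ _+_ (f≡c 0 z<s) (sumBelow-const n c (λ a a<n → f≡c (suc a) (s<s a<n)))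

sumBelow-zeros : ∀ n {f : ℕ → ℕ} → (∀ a → a < n → f a ≡ 0) → sumBelow n f ≡ 0
sumBelow-zeros n f≡0 = trans (sumBelow-const n 0 f≡0) (*-zeroʳ n)

sumBelow-padZeros : ∀ n d (f : ℕ → ℕ) → (∀ a → n ≤ a → f a ≡ 0) → sumBelow (n + d) f ≡ sumBelow n f
sumBelow-padZeros n d f vanish =
  trans (sumBelow-split n d f)
        (trans (cong (sumBelow n f +_) (sumBelow-zeros d (λ a _ → vanish (n + a) (m≤m+n n a))))
               (+-identityʳ _))

sumBelow-snoc : ∀ n (f : ℕ → ℕ) → sumBelow (suc n) f ≡ sumBelow n f + f n
sumBelow-snoc n f =
  trans (cong (λ m → sumBelow m f) (+-comm 1 n))
        (trans (sumBelow-split n 1 f)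
               (cong (sumBelow n f +_) (trans (+-identityʳ _) (cong f (+-identityʳ n)))))

sumBelow-blocks : ∀ Y P (F G : ℕ → ℕ) → (∀ x r → r < P → F (x * P + r) ≡ G x) →
                  sumBelow (Y * P) F ≡ P * sumBelow Y G
sumBelow-blocks zero    P F G block = sym (*-zeroʳ P)
sumBelow-blocks (suc Y) P F G block = begin
    sumBelow (P + Y * P) F
  ≡⟨ sumBelow-split P (Y * P) F ⟩
    sumBelow P F + sumBelow (Y * P) (λ r → F (P + r))
  ≡⟨ cong₂ _+_ (sumBelow-const P (G 0) (block 0))
               (sumBelow-blocks Y P (λ r → F (P + r)) (λ x → G (suc x))
                 (λ x r r<P → trans (cong F (sym (+-assoc P (x * P) r))) (block (suc x) r r<P))) ⟩
    P * G 0 + P * sumBelow Y (λ x → G (suc x))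
  ≡⟨ sym (*-distribˡ-+ P (G 0) _) ⟩
    P * sumBelow (suc Y) G
  ∎ where open ≡-Reasoning

sum-map-applyUpTo : ∀ n (g f : ℕ → ℕ) → sum (map f (applyUpTo g n)) ≡ sumBelow n (λ a → f (g a))
sum-map-applyUpTo zero    g f = refl
sum-map-applyUpTo (suc n) g f = cong (f (g 0) +_) (sum-map-applyUpTo n (λ a → g (suc a)) f)

module _ {A : Set} {ℓ} {P : Pred A ℓ} (P? : Decidable P) where

  length-filter-++ : ∀ xs ys → length (filter P? (xs ++ ys)) ≡ length (filter P? xs) + length (filter P? ys)
  length-filter-++ xs ys = trans (cong length (filter-++ P? xs ys)) (length-++ (filter P? xs))

  length-filter-concatMap : ∀ {B : Set} (h : B → List A) (bs : List B) →
    length (filter P? (concatMap h bs)) ≡ sum (map (λ b → length (filter P? (h b))) bs)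
  length-filter-concatMap h []       = refl
  length-filter-concatMap h (b ∷ bs) =
    trans (length-filter-++ (h b) (concat (map h bs))) (cong (length (filter P? (h b)) +_) (length-filter-concatMap h bs))

  length-filter-≐ : ∀ {Q : Pred A ℓ} (Q? : Decidable Q) → P ≐ Q → ∀ xs →
    length (filter P? xs) ≡ length (filter Q? xs)
  length-filter-≐ Q? P≐Q xs = cong length (filter-≐ P? Q? P≐Q xs)

length-filter-map : ∀ {A B : Set} {ℓ} {P : Pred B ℓ} (P? : Decidable P) (g : A → B) (xs : List A) →
  length (filter P? (map g xs)) ≡ length (filter (λ a → P? (g a)) xs)
length-filter-map P? g []       = refl
length-filter-map P? g (x ∷ xs) with does (P? (g x))
... | false = length-filter-map P? g xs
... | true  = cong suc (length-filter-map P? g xs)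

pow≥1 : ∀ b n → 1 ≤ b → 1 ≤ b ^ n
pow≥1 b zero    1≤b = ≤-refl
pow≥1 b (suc n) 1≤b = *-mono-≤ 1≤b (pow≥1 b n 1≤b)

n<pow : ∀ b n → 2 ≤ b → n < b ^ n
n<pow b zero    2≤b = z<s
n<pow b (suc n) 2≤b = begin-strict
    suc n
  <⟨ s≤s (m≤n+m (suc n) n) ⟩
    suc n + suc n
  ≡⟨ cong (suc n +_) (sym (+-identityʳ (suc n))) ⟩
    2 * suc n
  ≤⟨ *-mono-≤ 2≤b (n<pow b n 2≤b) ⟩
    b * b ^ n
  ∎ where open ≤-Reasoning

c≤c*pow : ∀ c b n → 1 ≤ b → c ≤ c * b ^ n
c≤c*pow c b n 1≤b = ≤-trans (≤-reflexive (sym (*-identityʳ c))) (*-monoʳ-≤ c (pow≥1 b n 1≤b))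

bound<prefactor*power : ∀ c b x B → 1 ≤ c → 2 ≤ b → x ≤ B → x < c * b * b ^ B
bound<prefactor*power c b x B 1≤c 2≤b x≤B = begin-strict
  x              ≤⟨ x≤B ⟩
  B              <⟨ <-trans (n<1+n B) (n<pow b (suc B) 2≤b) ⟩
  b * b ^ B      ≡⟨ cong (_* b ^ B) (sym (*-identityˡ b)) ⟩
  1 * b * b ^ B  ≤⟨ *-monoˡ-≤ (b ^ B) (*-monoˡ-≤ b 1≤c) ⟩
  c * b * b ^ B  ∎ where open ≤-Reasoning

indicator : ∀ {P : Set} → Dec P → ℕ
indicator (yes _) = 1
indicator (no  _) = 0

indicator-yes : ∀ {P : Set} (d : Dec P) → P → indicator d ≡ 1
indicator-yes (yes _) _  = refl
indicator-yes (no ¬h) h  = contradiction h ¬h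

indicator-no : ∀ {P : Set} (d : Dec P) → ¬ P → indicator d ≡ 0
indicator-no (yes h) ¬h = contradiction h ¬h
indicator-no (no  _) _  = refl

indicator-filter : ∀ {A P : Set} (d : Dec P) (a : A) → length (filter (λ _ → d) [ a ]) ≡ indicator d
indicator-filter (yes _) a = refl
indicator-filter (no  _) a = refl

indicator-mono : ∀ {c x x'} → x ≤ x' → indicator (c ≤? x) ≤ indicator (c ≤? x')
indicator-mono {c} {x} {x'} x≤x' with c ≤? x
... | yes c≤x = ≤-reflexive (sym (indicator-yes (c ≤? x') (≤-trans c≤x x≤x')))
... | no  _   = z≤n

indicator-scale : ∀ c x r P → r < P → indicator (c * P ≤? x * P + r) ≡ indicator (c ≤? x)
indicator-scale c x r P r<P with c ≤? x
... | yes c≤x = indicator-yes (_ ≤? _) (≤-trans (*-monoˡ-≤ P c≤x) (m≤m+n _ r))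
... | no  c≰x = indicator-no (_ ≤? _) (<⇒≱ (begin-strict
    x * P + r   <⟨ +-monoʳ-< (x * P) r<P ⟩
    x * P + P   ≡⟨ +-comm (x * P) P ⟩
    suc x * P   ≤⟨ *-monoˡ-≤ P (≰⇒> c≰x) ⟩
    c * P       ∎)) where open ≤-Reasoning

module Counting (p : ℕ → ℕ) where

  count : (i len c x B : ℕ) → ℕ
  count i zero      c x B = indicator (c ≤? x)
  count i (suc len) c x B = sumBelow (suc B) (λ a → count (suc i) len (c * p i ^ a) x B)

  count-list : ∀ i len c x B →
    length (filter (λ α → c * prodPow p i α ≤? x) (allVecs len B)) ≡ count i len c x B
  count-list i zero c x B =
    trans (length-filter-≐ (λ α → c * prodPow p i α ≤? x) (λ _ → c ≤? x)
                   ((λ {α} h → subst (_≤ x) (empty-product α) h) ,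
                    (λ {α} h → subst (_≤ x) (sym (empty-product α)) h))
                   (allVecs 0 B))
          (indicator-filter (c ≤? x) (Vec ℕ 0 ∋ []))
    where
    empty-product : (α : Vec ℕ 0) → c * prodPow p i α ≡ c
    empty-product [] = *-identityʳ c
  count-list i (suc len) c x B = begin
      length (filter P? (concatMap (λ a → map (a ∷_) (allVecs len B)) (upTo (suc B))))
    ≡⟨ length-filter-concatMap P? (λ a → map (a ∷_) (allVecs len B)) (upTo (suc B)) ⟩
      sum (map (λ a → length (filter P? (map (a ∷_) (allVecs len B)))) (upTo (suc B)))
    ≡⟨ sum-map-applyUpTo (suc B) (λ a → a) _ ⟩
      sumBelow (suc B) (λ a → length (filter P? (map (a ∷_) (allVecs len B))))
    ≡⟨ sumBelow-cong (suc B) (λ a _ → trans (length-filter-map P? (a ∷_) (allVecs len B))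
         (trans (length-filter-≐ (λ α → P? (a ∷ α)) (λ α → (c * p i ^ a) * prodPow p (suc i) α ≤? x)
                   ((λ h → subst (_≤ x) (sym (*-assoc c (p i ^ a) _)) h) ,
                    (λ h → subst (_≤ x) (*-assoc c (p i ^ a) _) h)) (allVecs len B))
                (count-list (suc i) len (c * p i ^ a) x B))) ⟩
      count i (suc len) c x B
    ∎ where
      open ≡-Reasoning
      P? : (α : Vec ℕ (suc len)) → Dec (c * prodPow p i α ≤ x)
      P? α = c * prodPow p i α ≤? x

  -- p(i), …, p(i+len-1) are all at least 2; this is what makes every count finite.
  Bases≥2 : ℕ → ℕ → Set
  Bases≥2 i len = ∀ r → r < len → 2 ≤ p (i + r)

  bases-tail : ∀ {i len} → Bases≥2 i (suc len) → Bases≥2 (suc i) len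
  bases-tail {i} large r r<len = subst (λ m → 2 ≤ p m) (+-suc i r) (large (suc r) (s<s r<len))

  bases-init : ∀ {i len} → Bases≥2 i (suc len) → Bases≥2 i len
  bases-init large r r<len = large r (m<n⇒m<1+n r<len)

  bases-head : ∀ {i len} → Bases≥2 i (suc len) → 2 ≤ p i
  bases-head {i} large = subst (λ m → 2 ≤ p m) (+-identityʳ i) (large 0 z<s)

  bases-head≥1 : ∀ {i len} → Bases≥2 i (suc len) → 1 ≤ p i
  bases-head≥1 large = ≤-trans (s≤s z≤n) (bases-head large)

  count-vanish : ∀ i len c x B → Bases≥2 i len → x < c → count i len c x B ≡ 0
  count-vanish i zero      c x B large x<c = indicator-no (c ≤? x) (<⇒≱ x<c)
  count-vanish i (suc len) c x B large x<c = sumBelow-zeros (suc B) (λ a _ →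
    count-vanish (suc i) len (c * p i ^ a) x B (bases-tail large)
      (<-≤-trans x<c (c≤c*pow c (p i) a (bases-head≥1 large))))

  count-pos : ∀ i len c x B → c ≤ x → 1 ≤ count i len c x B
  count-pos i zero      c x B c≤x = ≤-reflexive (sym (indicator-yes (c ≤? x) c≤x))
  count-pos i (suc len) c x B c≤x =
    ≤-trans (count-pos (suc i) len (c * 1) x B (subst (_≤ x) (sym (*-identityʳ c)) c≤x)) (m≤m+n _ _)

  count-mono : ∀ i len c x x' B → x ≤ x' → count i len c x B ≤ count i len c x' B
  count-mono i zero      c x x' B x≤x' = indicator-mono x≤x'
  count-mono i (suc len) c x x' B x≤x' =
    sumBelow-mono (suc B) (λ a _ → count-mono (suc i) len (c * p i ^ a) x x' B x≤x')

  -- The exponent bound B is irrelevant once B ≥ x: a qualifying tuple has α_r < p^{α_r} ≤ x.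
  count-truncate : ∀ i len c x B → Bases≥2 i len → 1 ≤ c → x ≤ B → count i len c x B ≡ count i len c x x
  count-truncate i zero      c x B large 1≤c x≤B = refl
  count-truncate i (suc len) c x B large 1≤c x≤B = begin
      sumBelow (suc B) (λ a → count (suc i) len (c * p i ^ a) x B)
    ≡⟨ sumBelow-cong (suc B) (λ a _ → count-truncate (suc i) len (c * p i ^ a) x B (bases-tail large)
                                        (≤-trans 1≤c (c≤c*pow c (p i) a (bases-head≥1 large))) x≤B) ⟩
      sumBelow (suc B) F
    ≡⟨ cong (λ m → sumBelow (suc m) F) (sym (m+[n∸m]≡n x≤B)) ⟩
      sumBelow (suc x + (B ∸ x)) F
    ≡⟨ sumBelow-padZeros (suc x) (B ∸ x) F (λ a x<a →
         count-vanish (suc i) len _ x x (bases-tail large) (exponent-too-large a x<a)) ⟩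
      sumBelow (suc x) F
    ∎ where
      open ≡-Reasoning
      F : ℕ → ℕ
      F a = count (suc i) len (c * p i ^ a) x x
      exponent-too-large : ∀ a → x < a → x < c * p i ^ a
      exponent-too-large a x<a = <-≤-trans (<-trans x<a (n<pow (p i) a (bases-head large)))
                                           (≤-trans (≤-reflexive (sym (*-identityˡ _))) (*-monoˡ-≤ (p i ^ a) 1≤c))

  count-scale : ∀ i len c x r P B → r < P → count i len (c * P) (x * P + r) B ≡ count i len c x B
  count-scale i zero      c x r P B r<P = indicator-scale c x r P r<P
  count-scale i (suc len) c x r P B r<P = sumBelow-cong (suc B) (λ a _ →
    trans (cong (λ d → count (suc i) len d (x * P + r) B) (*-swapʳ c P (p i ^ a)))
          (count-scale (suc i) len (c * p i ^ a) x r P B r<P))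

  -- Splitting on the last exponent: it is 0 (a tuple of length len remains) or it is ≥ 1
  -- (one factor p(i+len) can be moved into the prefactor).
  count-splitLast : ∀ i len c x B → Bases≥2 i (suc len) → 1 ≤ c → x ≤ B →
    count i (suc len) c x B ≡ count i len c x B + count i (suc len) (c * p (i + len)) x B
  count-splitLast i zero c x B large 1≤c x≤B = begin
      indicator (c * 1 ≤? x) + sumBelow B (λ a → indicator (c * (p i * p i ^ a) ≤? x))
    ≡⟨ cong₂ _+_ (cong (λ d → indicator (d ≤? x)) (*-identityʳ c))
         (sumBelow-cong B (λ a _ → cong (λ d → indicator (d ≤? x)) (sym (*-assoc c (p i) _)))) ⟩
      indicator (c ≤? x) + sumBelow B F
    ≡⟨ cong (indicator (c ≤? x) +_)
         (sym (trans (sumBelow-snoc B F) (trans (cong (sumBelow B F +_) last-vanishes) (+-identityʳ _)))) ⟩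
      indicator (c ≤? x) + sumBelow (suc B) F
    ≡⟨ cong (λ m → indicator (c ≤? x) + sumBelow (suc B) (λ a → indicator (c * p m * p i ^ a ≤? x)))
            (sym (+-identityʳ i)) ⟩
      indicator (c ≤? x) + sumBelow (suc B) (λ a → indicator (c * p (i + 0) * p i ^ a ≤? x))
    ∎ where
      open ≡-Reasoning
      F : ℕ → ℕ
      F a = indicator (c * p i * p i ^ a ≤? x)
      last-vanishes : F B ≡ 0
      last-vanishes = indicator-no (_ ≤? x) (<⇒≱ (bound<prefactor*power c (p i) x B 1≤c (bases-head large) x≤B))
  count-splitLast i (suc len) c x B large 1≤c x≤B = begin
      sumBelow (suc B) (λ a → count (suc i) (suc len) (c * p i ^ a) x B)
    ≡⟨ sumBelow-cong (suc B) (λ a _ → count-splitLast (suc i) len (c * p i ^ a) x B (bases-tail large)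
                                        (≤-trans 1≤c (c≤c*pow c (p i) a (bases-head≥1 large))) x≤B) ⟩
      sumBelow (suc B) (λ a → count (suc i) len (c * p i ^ a) x B + F a)
    ≡⟨ sumBelow-+ (suc B) (λ a → count (suc i) len (c * p i ^ a) x B) F ⟩
      count i (suc len) c x B + sumBelow (suc B) F
    ≡⟨ cong (count i (suc len) c x B +_) (sumBelow-cong (suc B) (λ a _ →
         cong (λ d → count (suc i) (suc len) d x B)
           (trans (*-swapʳ c (p i ^ a) _) (cong (λ m → c * p m * p i ^ a) (sym (+-suc i len)))))) ⟩
      count i (suc len) c x B + count i (suc (suc len)) (c * p (i + suc len)) x B
    ∎ where
      open ≡-Reasoning
      F : ℕ → ℕ
      F a = count (suc i) (suc len) (c * p i ^ a * p (suc i + len)) x B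

module ExponentCounts (p : ℕ → ℕ) where
  open Counting p public

  -- N k y = #{ (α_3,…,α_{3+k}) | ∏ p_i^{α_i} ≤ y }, the counting function of (u^{3+k}_l)_l.
  N : ℕ → ℕ → ℕ
  N k y = count 3 (suc k) 1 y y

  -- The tuples counted by N k y whose last exponent α_{3+k} is zero, resp. positive.
  -- Note that N₀ (suc k) is N k by definition.
  N₀ N₊ : ℕ → ℕ → ℕ
  N₀ k y = count 3 k 1 y y
  N₊ k y = count 3 (suc k) (1 * p (3 + k)) y y

  -- The tuple (0,…,0) is counted as soon as y ≥ 1.
  N-pos : ∀ {k y} → 1 ≤ y → 1 ≤ N k y
  N-pos {k} {y} = count-pos 3 (suc k) 1 y y

  N₀-pos : ∀ {k y} → 1 ≤ y → 1 ≤ N₀ k y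
  N₀-pos {k} {y} = count-pos 3 k 1 y y

  module _ {k : ℕ} (large : Bases≥2 3 (suc k)) where

    private
      P≥1 : 1 ≤ p (3 + k)
      P≥1 = ≤-trans (s≤s z≤n) (large k ≤-refl)

      count-grows : ∀ c x x' → 1 ≤ c → x ≤ x' → count 3 (suc k) c x x ≤ count 3 (suc k) c x' x'
      count-grows c x x' 1≤c x≤x' =
        ≤-trans (≤-reflexive (sym (count-truncate 3 (suc k) c x x' large 1≤c x≤x')))
                (count-mono 3 (suc k) c x x' x' x≤x')

    N-mono : ∀ {x x'} → x ≤ x' → N k x ≤ N k x'
    N-mono = count-grows 1 _ _ ≤-refl

    N₊-mono : ∀ {x x'} → x ≤ x' → N₊ k x ≤ N₊ k x'
    N₊-mono = count-grows (1 * p (3 + k)) _ _ (subst (1 ≤_) (sym (*-identityˡ _)) P≥1)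

    N-split : ∀ y → N k y ≡ N₀ k y + N₊ k y
    N-split y = count-splitLast 3 k 1 y y large ≤-refl ≤-refl

    -- Dropping one factor of P = p(3+k) from tuples with α_{3+k} ≥ 1: N₊ k (xP + r) = N k x.
    N₊-scale : ∀ x r → r < p (3 + k) → N₊ k (x * p (3 + k) + r) ≡ N k x
    N₊-scale x r r<P =
      trans (count-scale 3 (suc k) 1 x r (p (3 + k)) _ r<P)
            (count-truncate 3 (suc k) 1 x _ large ≤-refl x≤xP+r)
      where
      x≤xP+r : x ≤ x * p (3 + k) + r
      x≤xP+r = ≤-trans (≤-trans (≤-reflexive (sym (*-identityʳ x))) (*-monoʳ-≤ x P≥1)) (m≤m+n _ r)

    N-zero : N k 0 ≡ 0
    N-zero = count-vanish 3 (suc k) 1 0 0 large ≤-refl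

    -- Since N k 0 = 0, a sample length covering a positive count is positive.
    N-covers⇒pos : ∀ {m Y} → suc m ≤ N k Y → 1 ≤ Y
    N-covers⇒pos {m} {zero} m<N = contradiction (subst (suc m ≤_) N-zero m<N) (λ ())
    N-covers⇒pos {m} {suc _} _  = s≤s z≤n

    N₊-zero : N₊ k 0 ≡ 0
    N₊-zero = count-vanish 3 (suc k) _ 0 0 large (subst (1 ≤_) (sym (*-identityˡ _)) P≥1)

    -- N k is unbounded: N k (P^n) ≥ n, since 1, P, …, P^n are all ≤ P^n.
    N-unbounded : ∀ n → n ≤ N k (p (3 + k) ^ n)
    N-unbounded zero    = z≤n
    N-unbounded (suc n) = begin
        1 + n
      ≤⟨ +-mono-≤ (N₀-pos {k} (pow≥1 P (suc n) P≥1)) (N-unbounded n) ⟩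
        N₀ k (P ^ suc n) + N k (P ^ n)
      ≡⟨ cong (N₀ k (P ^ suc n) +_) (sym (trans (cong (N₊ k) P^[n+1]≡P^n*P+0) (N₊-scale (P ^ n) 0 P≥1))) ⟩
        N₀ k (P ^ suc n) + N₊ k (P ^ suc n)
      ≡⟨ sym (N-split (P ^ suc n)) ⟩
        N k (P ^ suc n)
      ∎ where
        open ≤-Reasoning
        P : ℕ
        P = p (3 + k)
        P^[n+1]≡P^n*P+0 : P ^ suc n ≡ P ^ n * P + 0
        P^[n+1]≡P^n*P+0 = trans (*-comm P (P ^ n)) (sym (+-identityʳ _))

  N-step : ∀ {k} → Bases≥2 3 (suc (suc k)) → ∀ y → N k y ≤ N (suc k) y
  N-step large y = ≤-trans (m≤m+n _ _) (≤-reflexive (sym (N-split large y)))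

  prodPow≥1 : ∀ i len → Bases≥2 i len → (α : Vec ℕ len) → 1 ≤ prodPow p i α
  prodPow≥1 i zero      large []       = ≤-refl
  prodPow≥1 i (suc len) large (a ∷ α) =
    *-mono-≤ (pow≥1 (p i) a (bases-head≥1 large)) (prodPow≥1 (suc i) len (bases-tail large) α)

  countLe≡N : ∀ k x → countLe p (3 + k) x ≡ N k x
  countLe≡N k x =
    trans (length-filter-≐ (λ α → prodPow p 3 α ≤? x) (λ α → 1 * prodPow p 3 α ≤? x)
                   ((λ h → subst (_≤ x) (sym (*-identityˡ _)) h) , (λ h → subst (_≤ x) (*-identityˡ _) h))
                   (allVecs (suc k) x))
          (count-list 3 (suc k) 1 x x)

  countLt≡N : ∀ k x → Bases≥2 3 (suc k) → countLt p (3 + k) x ≡ N k (pred x)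
  countLt≡N k x large =
    trans (length-filter-≐ (λ α → prodPow p 3 α <? x) (λ α → 1 * prodPow p 3 α ≤? pred x)
                   ((λ h → subst (_≤ pred x) (sym (*-identityˡ _)) (<⇒≤pred h)) ,
                    (λ {α} h → below x α (subst (_≤ pred x) (*-identityˡ _) h)))
                   (allVecs (suc k) x))
          (trans (count-list 3 (suc k) 1 (pred x) x)
                 (count-truncate 3 (suc k) 1 (pred x) x large ≤-refl pred[n]≤n))
    where
    below : ∀ x (α : Vec ℕ (suc k)) → prodPow p 3 α ≤ pred x → prodPow p 3 α < x
    below zero    α h = contradiction (≤-trans (prodPow≥1 3 (suc k) large α) h) (λ ())
    below (suc x) α h = s≤s h

  -- IsNth k l w : w = u^{3+k}_l, phrased through the counting function N k.
  record IsNth (k l w : ℕ) : Set where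
    constructor nth
    field
      before  : N k (pred w) < l
      reached : l ≤ N k w

  IsU⇒IsNth : ∀ {k l w} → Bases≥2 3 (suc k) → IsU p (3 + k) l w → IsNth k l w
  IsU⇒IsNth {k} {l} {w} large (lo , hi) =
    nth (subst (_< l) (countLt≡N k w large) lo) (subst (l ≤_) (countLe≡N k w) hi)

  IsNth⇒IsU : ∀ {k l w} → Bases≥2 3 (suc k) → IsNth k l w → IsU p (3 + k) l w
  IsNth⇒IsU {k} {l} {w} large (nth lo hi) =
    subst (_< l) (sym (countLt≡N k w large)) lo , subst (l ≤_) (sym (countLe≡N k w)) hi

  nth-mono : ∀ {k j w v} → Bases≥2 3 (suc k) → IsNth k j w → IsNth k (suc j) v → w ≤ v
  nth-mono {k} {j} {w} {v} large (nth lo _) (nth _ hi) with w ≤? v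
  ... | yes w≤v = w≤v
  ... | no  w≰v =
    contradiction (≤-trans hi (≤-trans (N-mono large (<⇒≤pred (≰⇒> w≰v))) (<⇒≤ lo))) 1+n≰n

  nth-lift : ∀ {k j v} → Bases≥2 3 (suc (suc k)) → IsNth k (suc j) v →
    IsNth (suc k) (suc j + N₊ (suc k) (pred v)) v
  nth-lift {k} {j} {v} large (nth lo hi) = nth
    (subst (_< suc j + N₊ (suc k) (pred v)) (sym (N-split large (pred v))) (+-monoˡ-< _ lo))
    (subst (suc j + N₊ (suc k) (pred v) ≤_) (sym (N-split large v)) (+-mono-≤ hi (N₊-mono large pred[n]≤n)))

  -- The position k_j: with w = u^{3+k}_j, k_j = j + N₊ (k+1) (w - 1), i.e. j plus the
  -- number of terms of u^{4+k} below w involving p_{4+k}.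
  KIndex : ℕ → ℕ → ℕ → Set
  KIndex k j l = ∃ λ w → IsNth k j w × l ≡ j + N₊ (suc k) (pred w)

  -- In the step, with v = u^{3+k}_{j+1}, the number c = j + 1 +
  -- N₊ (k+1) (v - 1) satisfies u^{4+k}_c = v (nth-lift) and exceeds k_j, so minimality
  -- gives k_{j+1} ≤ c; conversely c ≤ k_{j+1}: if u_j < v then c - 1 ≤ N (k+1) (v - 1) <
  -- k_{j+1}, and if u_j = v then c = k_j + 1.
  IsK⇒KIndex : ∀ {k j l} → Bases≥2 3 (suc (suc k)) → IsK p (4 + k) j l → KIndex k j l
  IsK⇒KIndex {k} large k-one =
    1 , nth (subst (_< 1) (sym (N-zero large′)) (s≤s z≤n)) (N-pos {k} (s≤s z≤n)) ,
    sym (cong suc (N₊-zero large))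
    where
    large′ : Bases≥2 3 (suc k)
    large′ = bases-init large
  IsK⇒KIndex {k} large (k-suc {j} {a} {b} isK a<b (v , Uᵇ , Uʲ) minimal) with IsK⇒KIndex large isK
  ... | w , nth-w , a≡ = v , nth-v , ≤-antisym b≤c c≤b
    where
    large′ : Bases≥2 3 (suc k)
    large′ = bases-init large
    nth-v : IsNth k (suc j) v
    nth-v = IsU⇒IsNth large′ Uʲ
    w≤v : w ≤ v
    w≤v = nth-mono large′ nth-w nth-v
    c : ℕ
    c = suc j + N₊ (suc k) (pred v)
    a<c : a < c
    a<c = subst (_< c) (sym a≡) (s≤s (+-monoʳ-≤ j (N₊-mono large (pred-mono-≤ w≤v))))
    b≤c : b ≤ c
    b≤c = ≮⇒≥ (λ c<b → minimal c a<c c<b (v , IsNth⇒IsU large (nth-lift large nth-v) , Uʲ))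
    c≤b : c ≤ b
    c≤b with m≤n⇒m<n∨m≡n w≤v
    ... | inj₂ refl = subst (_< b) a≡ a<b
    ... | inj₁ w<v  = ≤-trans (s≤s (+-monoˡ-≤ _ (≤-trans (IsNth.reached nth-w)
                                                         (N-mono large′ (<⇒≤pred w<v)))))
                              (subst (_< b) (N-split large (pred v)) (IsNth.before (IsU⇒IsNth large Uᵇ)))

  KIndex⇒≥ : ∀ {k j l} → KIndex k j l → j ≤ l
  KIndex⇒≥ {k} {j} (w , _ , l≡) = subst (j ≤_) (sym l≡) (m≤m+n j _)

minOver-≤ : ∀ n (f : ℕ → ℕ) t → 1 ≤ t → t ≤ suc n → minOver (suc n) f ≤ f t
minOver-≤ zero    f (suc zero)    _   _          = ≤-refl
minOver-≤ zero    f (suc (suc t)) _   (s≤s ())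
minOver-≤ (suc n) f t             1≤t t≤n+2 with m≤n⇒m<n∨m≡n t≤n+2
... | inj₁ t<n+2 = ≤-trans (m⊓n≤m _ _) (minOver-≤ n f t 1≤t (s≤s⁻¹ t<n+2))
... | inj₂ refl  = m⊓n≤n _ _

minOver-attained : ∀ n (f : ℕ → ℕ) → ∃ λ t → 1 ≤ t × t ≤ suc n × minOver (suc n) f ≡ f t
minOver-attained zero    f = 1 , ≤-refl , ≤-refl , refl
minOver-attained (suc n) f with minOver-attained n f | ⊓-sel (minOver (suc n) f) (f (suc (suc n)))
... | t , 1≤t , t≤n+1 , eq | inj₁ e = t , 1≤t , m≤n⇒m≤1+n t≤n+1 , trans e eq
... | _                    | inj₂ e = suc (suc n) , s≤s z≤n , ≤-refl , e

minOver-unique : ∀ n (f : ℕ → ℕ) v → (∀ t → 1 ≤ t → t ≤ suc n → v ≤ f t) →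
  (∃ λ t → 1 ≤ t × t ≤ suc n × f t ≡ v) → minOver (suc n) f ≡ v
minOver-unique n f v below (t , 1≤t , t≤n+1 , ft≡v) with minOver-attained n f
... | t₀ , 1≤t₀ , t₀≤n+1 , min≡ft₀ =
  ≤-antisym (≤-trans (minOver-≤ n f t 1≤t t≤n+1) (≤-reflexive ft≡v))
            (≤-trans (below t₀ 1≤t₀ t₀≤n+1) (≤-reflexive (sym min≡ft₀)))

crossing : ∀ (f : ℕ → ℕ) M W → f 0 < M → M ≤ f W → ∃ λ y → y < W × f y < M × M ≤ f (suc y)
crossing f M zero    f0<M M≤fW = contradiction M≤fW (<⇒≱ f0<M)
crossing f M (suc W) f0<M M≤fW with M ≤? f W
... | yes M≤f = let (y , y<W , below , above) = crossing f M W f0<M M≤f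
                in y , m<n⇒m<1+n y<W , below , above
... | no  M≰f = W , ≤-refl , ≰⇒> M≰f , M≤fW

split-in-boxes : ∀ a₀ a₁ b₀ b₁ M → a₀ ≤ a₁ → b₀ ≤ b₁ → 1 ≤ b₁ → b₀ + a₀ < M → M ≤ b₁ + a₁ →
  ∃ λ t → 1 ≤ t × t ≤ M × b₀ ≤ t × t ≤ b₁ × a₀ ≤ M ∸ t × M ∸ t ≤ a₁
split-in-boxes a₀ a₁ b₀ b₁ M a₀≤a₁ b₀≤b₁ 1≤b₁ lo hi with b₁ + a₀ ≤? M
... | yes b₁+a₀≤M =
  b₁ , 1≤b₁ , ≤-trans (m≤m+n b₁ a₀) b₁+a₀≤M , b₀≤b₁ , ≤-refl ,
  m+n≤o⇒m≤o∸n a₀ (subst (_≤ M) (+-comm b₁ a₀) b₁+a₀≤M) , m≤n+o⇒m∸n≤o M b₁ hi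
... | no  b₁+a₀≰M =
  M ∸ a₀ , m<n⇒0<n∸m a₀<M , m∸n≤m M a₀ , m+n≤o⇒m≤o∸n b₀ (<⇒≤ lo) ,
  m≤n+o⇒m∸n≤o M a₀ (subst (M ≤_) (+-comm b₁ a₀) (<⇒≤ (≰⇒> b₁+a₀≰M))) ,
  ≤-reflexive (sym (m∸[m∸n]≡n (<⇒≤ a₀<M))) , ≤-trans (≤-reflexive (m∸[m∸n]≡n (<⇒≤ a₀<M))) a₀≤a₁
  where
  a₀<M : a₀ < M
  a₀<M = ≤-<-trans (m≤n+m a₀ b₀) lo

∸-subadditive : ∀ a b x z → (a + b) ∸ (z + x) ≤ (a ∸ x) + (b ∸ z)
∸-subadditive a b x z = m≤n+o⇒m∸n≤o (a + b) (z + x) (begin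
    a + b
  ≤⟨ +-mono-≤ (m≤n+m∸n a x) (m≤n+m∸n b z) ⟩
    (x + (a ∸ x)) + (z + (b ∸ z))
  ≡⟨ +-interchange x (a ∸ x) z (b ∸ z) ⟩
    (x + z) + ((a ∸ x) + (b ∸ z))
  ≡⟨ cong (_+ ((a ∸ x) + (b ∸ z))) (+-comm x z) ⟩
    (z + x) + ((a ∸ x) + (b ∸ z))
  ∎) where open ≤-Reasoning

∸-additive : ∀ a b x z → (x ≤ a × z ≤ b) ⊎ (a ≤ x × b ≤ z) → (a ∸ x) + (b ∸ z) ≡ (a + b) ∸ (z + x)
∸-additive a b x z (inj₁ (x≤a , z≤b)) = sym (begin
    (a + b) ∸ (z + x)   ≡⟨ sym (∸-+-assoc (a + b) z x) ⟩
    (a + b) ∸ z ∸ x     ≡⟨ cong (_∸ x) (+-∸-assoc a z≤b) ⟩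
    (a + (b ∸ z)) ∸ x   ≡⟨ +-∸-comm (b ∸ z) x≤a ⟩
    (a ∸ x) + (b ∸ z)   ∎) where open ≡-Reasoning
∸-additive a b x z (inj₂ (a≤x , b≤z)) =
  trans (cong₂ _+_ (m≤n⇒m∸n≡0 a≤x) (m≤n⇒m∸n≡0 b≤z))
        (sym (m≤n⇒m∸n≡0 (subst (a + b ≤_) (+-comm x z) (+-mono-≤ a≤x b≤z))))

module ClosedForm (p q : ℕ → ℕ) where
  open ExponentCounts p public

  qProd : ℕ → ℕ
  qProd zero    = q 3
  qProd (suc k) = q (4 + k) * qProd k

  -- uSum k n Y = Σ_{y<Y} (n ∸ N k y).  As #{y | N k y < l} = u^{3+k}_l, this is
  -- u_1 + ⋯ + u_n as soon as n ≤ N k Y (all later terms vanish).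
  uSum : ℕ → ℕ → ℕ → ℕ
  uSum k n Y = sumBelow Y (λ y → n ∸ N k y)

  uSum-zero : ∀ k Y → uSum k 0 Y ≡ 0
  uSum-zero k Y = sumBelow-zeros Y (λ y _ → 0∸n≡0 (N k y))

  uSum-extend : ∀ {k n Y Y'} → Bases≥2 3 (suc k) → Y ≤ Y' → n ≤ N k Y → uSum k n Y ≡ uSum k n Y'
  uSum-extend {k} {n} {Y} {Y'} large Y≤Y' n≤N =
    trans (sym (sumBelow-padZeros Y (Y' ∸ Y) _ (λ y Y≤y → m≤n⇒m∸n≡0 (≤-trans n≤N (N-mono large Y≤y)))))
          (cong (uSum k n) (m+[n∸m]≡n Y≤Y'))

  uSum-stable : ∀ {k n Y₁ Y₂} → Bases≥2 3 (suc k) → n ≤ N k Y₁ → n ≤ N k Y₂ → uSum k n Y₁ ≡ uSum k n Y₂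
  uSum-stable {Y₁ = Y₁} {Y₂} large n≤N₁ n≤N₂ with ≤-total Y₁ Y₂
  ... | inj₁ Y₁≤Y₂ = uSum-extend large Y₁≤Y₂ n≤N₁
  ... | inj₂ Y₂≤Y₁ = sym (uSum-extend large Y₂≤Y₁ n≤N₂)

  -- Grouping y < ZP into Z blocks of length P = p(3+k), on which N₊ k is constant.
  N₊-sum : ∀ {k} → Bases≥2 3 (suc k) → ∀ m Z →
    sumBelow (Z * p (3 + k)) (λ y → m ∸ N₊ k y) ≡ p (3 + k) * uSum k m Z
  N₊-sum {k} large m Z =
    sumBelow-blocks Z (p (3 + k)) (λ y → m ∸ N₊ k y) (λ x → m ∸ N k x)
                    (λ x r r<P → cong (m ∸_) (N₊-scale large x r r<P))

  -- Sample lengths for level k: reach k M is long enough for N k to pass M, and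
  -- window k M = reach k M · p(4+k) is the corresponding length one level up.
  reach window : ℕ → ℕ → ℕ
  reach  k M = p (3 + k) ^ M
  window k M = reach k M * p (4 + k)

  module _ {k : ℕ} (large : Bases≥2 3 (suc (suc k))) (M : ℕ) where

    reach-covers : M ≤ N k (reach k M)
    reach-covers = N-unbounded (bases-init large) M

    reach-covers-next : M ≤ N (suc k) (reach k M)
    reach-covers-next = ≤-trans reach-covers (N-step large _)

    window-covers : M ≤ N k (window k M)
    window-covers = ≤-trans reach-covers (N-mono (bases-init large) reach≤window)
      where
      reach≤window : reach k M ≤ window k M
      reach≤window = ≤-trans (≤-reflexive (sym (*-identityʳ _)))
                             (*-monoʳ-≤ (reach k M) (≤-trans (s≤s z≤n) (large (suc k) ≤-refl)))

    window-covers-next : M ≤ N (suc k) (window k M)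
    window-covers-next = ≤-trans window-covers (N-step large _)

  -- The sum describing the split M = (M - t) + t at level k + 1: by
  -- N (k+1) = N k + N₊ (k+1) it compares term by term with uSum (k+1) M.
  splitSum : ℕ → ℕ → ℕ → ℕ → ℕ
  splitSum k M t W = sumBelow W (λ y → ((M ∸ t) ∸ N₊ (suc k) y) + (t ∸ N k y))

  splitSum-blocks : ∀ {k} → Bases≥2 3 (suc (suc k)) → ∀ M t Z →
    p (4 + k) * uSum (suc k) (M ∸ t) Z + uSum k t (Z * p (4 + k)) ≡ splitSum k M t (Z * p (4 + k))
  splitSum-blocks {k} large M t Z =
    trans (cong (_+ uSum k t (Z * p (4 + k))) (sym (N₊-sum large (M ∸ t) Z)))
          (sym (sumBelow-+ (Z * p (4 + k)) (λ y → (M ∸ t) ∸ N₊ (suc k) y) (λ y → t ∸ N k y)))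

  splitSum-≥ : ∀ {k M t} W → Bases≥2 3 (suc (suc k)) → t ≤ M → uSum (suc k) M W ≤ splitSum k M t W
  splitSum-≥ {k} {M} {t} W large t≤M = sumBelow-mono W (λ y _ → begin
      M ∸ N (suc k) y
    ≡⟨ cong₂ _∸_ (sym (m∸n+n≡m t≤M)) (N-split large y) ⟩
      ((M ∸ t) + t) ∸ (N k y + N₊ (suc k) y)
    ≤⟨ ∸-subadditive (M ∸ t) t (N₊ (suc k) y) (N k y) ⟩
      ((M ∸ t) ∸ N₊ (suc k) y) + (t ∸ N k y)
    ∎) where open ≤-Reasoning

  -- At sample y the split is exact when both parts are covered, or both are exhausted.
  data Balanced (k M t y : ℕ) : Set where
    both-covered   : N₊ (suc k) y ≤ M ∸ t → N k y ≤ t → Balanced k M t y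
    both-exhausted : M ∸ t ≤ N₊ (suc k) y → t ≤ N k y → Balanced k M t y

  balanced⇒additive : ∀ {k M t y} → Balanced k M t y →
    (N₊ (suc k) y ≤ M ∸ t × N k y ≤ t) ⊎ (M ∸ t ≤ N₊ (suc k) y × t ≤ N k y)
  balanced⇒additive (both-covered   a b) = inj₁ (a , b)
  balanced⇒additive (both-exhausted a b) = inj₂ (a , b)

  balanced-tie : ∀ {k M t y} → N k y ≡ t → Balanced k M t y
  balanced-tie {k} {M} {t} {y} Nky≡t with ≤-total (N₊ (suc k) y) (M ∸ t)
  ... | inj₁ covered   = both-covered   covered   (≤-reflexive Nky≡t)
  ... | inj₂ exhausted = both-exhausted exhausted (≤-reflexive (sym Nky≡t))

  splitSum-balanced : ∀ {k M t} W → Bases≥2 3 (suc (suc k)) → t ≤ M →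
    (∀ y → y < W → Balanced k M t y) → splitSum k M t W ≡ uSum (suc k) M W
  splitSum-balanced {k} {M} {t} W large t≤M balanced = sumBelow-cong W (λ y y<W → begin
      ((M ∸ t) ∸ N₊ (suc k) y) + (t ∸ N k y)
    ≡⟨ ∸-additive (M ∸ t) t (N₊ (suc k) y) (N k y) (balanced⇒additive (balanced y y<W)) ⟩
      ((M ∸ t) + t) ∸ (N k y + N₊ (suc k) y)
    ≡⟨ cong₂ _∸_ (m∸n+n≡m t≤M) (sym (N-split large y)) ⟩
      M ∸ N (suc k) y
    ∎) where open ≡-Reasoning

  -- Some split 1 ≤ t ≤ M is balanced at every sample: cut where N (k+1) crosses M.
  balanced-split-exists : ∀ {k M} W → Bases≥2 3 (suc (suc k)) → 0 < M → M ≤ N (suc k) W →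
    ∃ λ t → 1 ≤ t × t ≤ M × (∀ y → y < W → Balanced k M t y)
  balanced-split-exists {k} {M} W large 0<M M≤N
    with crossing (N (suc k)) M W (subst (_< M) (sym (N-zero large)) 0<M) M≤N
  ... | y₀ , _ , below , above
    with split-in-boxes (N₊ (suc k) y₀) (N₊ (suc k) (suc y₀)) (N k y₀) (N k (suc y₀)) M
           (N₊-mono large (n≤1+n y₀)) (N-mono (bases-init large) (n≤1+n y₀)) (N-pos {k} (s≤s z≤n))
           (subst (_< M) (N-split large y₀) below) (subst (M ≤_) (N-split large (suc y₀)) above)
  ... | t , 1≤t , t≤M , lo-t , t-hi , lo-Mt , Mt-hi = t , 1≤t , t≤M , balanced
    where
    large′ : Bases≥2 3 (suc k)
    large′ = bases-init large
    balanced : ∀ y → y < W → Balanced k M t y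
    balanced y _ with y ≤? y₀
    ... | yes y≤y₀ = both-covered   (≤-trans (N₊-mono large y≤y₀) lo-Mt) (≤-trans (N-mono large′ y≤y₀) lo-t)
    ... | no  y≰y₀ = both-exhausted (≤-trans Mt-hi (N₊-mono large (≰⇒> y≰y₀)))
                                    (≤-trans t-hi (N-mono large′ (≰⇒> y≰y₀)))

  ClosedAt : ℕ → (ℕ → ℕ) → Set
  ClosedAt k g = ∀ n Y → n ≤ N k Y → g n ≡ qProd k * uSum k n Y

  -- At level 3, N 0 (y+1) = 1 + N₊ 0 (y+1): passing from n to n+1 adds 1 for y = 0 and
  -- shifts every other term onto the p_3-scaled samples.
  uSum₀-shift : Bases≥2 3 1 → ∀ n W → 1 ≤ W → uSum 0 (suc n) W ≡ suc (sumBelow W (λ y → n ∸ N₊ 0 y))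
  uSum₀-shift large n (suc V) _ = begin
      (suc n ∸ N 0 0) + sumBelow V (λ y → suc n ∸ N 0 (suc y))
    ≡⟨ cong₂ _+_ (cong (suc n ∸_) (N-zero large))
                 (sumBelow-cong V (λ y _ → cong (suc n ∸_) (N-split large (suc y)))) ⟩
      suc n + sumBelow V (λ y → suc n ∸ (N₀ 0 (suc y) + N₊ 0 (suc y)))
    ≡⟨ cong (suc n +_) (sumBelow-cong V (λ y _ →
         cong (λ c → suc n ∸ (c + N₊ 0 (suc y))) (indicator-yes (1 ≤? suc y) (s≤s z≤n)))) ⟩
      suc n + sumBelow V (λ y → n ∸ N₊ 0 (suc y))
    ≡⟨ cong (λ v → suc (v + sumBelow V (λ y → n ∸ N₊ 0 (suc y)))) (cong (n ∸_) (sym (N₊-zero large))) ⟩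
      suc ((n ∸ N₊ 0 0) + sumBelow V (λ y → n ∸ N₊ 0 (suc y)))
    ∎ where open ≡-Reasoning

  -- Base case m = 3: G_3(n+1) = p_3 G_3(n) + q_3 matches uSum 0 (n+1) = 1 + p_3 · uSum 0 n.
  G3-closed : Bases≥2 3 1 → ClosedAt 0 (G p q 3)
  G3-closed large zero    Y _ = sym (trans (cong (q 3 *_) (uSum-zero 0 Y)) (*-zeroʳ (q 3)))
  G3-closed large (suc n) Y n<N = begin
      p 3 * G3 p q n + q 3
    ≡⟨ cong (λ v → p 3 * v + q 3) (G3-closed large n Y (≤-trans (n≤1+n n) n<N)) ⟩
      p 3 * (q 3 * uSum 0 n Y) + q 3
    ≡⟨ factor (p 3) (q 3) (uSum 0 n Y) ⟩
      q 3 * suc (p 3 * uSum 0 n Y)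
    ≡⟨ cong (q 3 *_) (sym uSum-step) ⟩
      q 3 * uSum 0 (suc n) Y
    ∎ where
      open ≡-Reasoning
      factor : ∀ a b s → a * (b * s) + b ≡ b * suc (a * s)
      factor = solve-∀
      1≤Y : 1 ≤ Y
      1≤Y = N-covers⇒pos large n<N
      uSum-step : uSum 0 (suc n) Y ≡ suc (p 3 * uSum 0 n Y)
      uSum-step = begin
          uSum 0 (suc n) Y
        ≡⟨ uSum-extend large Y≤YP n<N ⟩
          uSum 0 (suc n) (Y * p 3)
        ≡⟨ uSum₀-shift large n (Y * p 3) (*-mono-≤ 1≤Y (bases-head≥1 large)) ⟩
          suc (sumBelow (Y * p 3) (λ y → n ∸ N₊ 0 y))
        ≡⟨ cong suc (N₊-sum large n Y) ⟩
          suc (p 3 * uSum 0 n Y)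
        ∎ where
          Y≤YP : Y ≤ Y * p 3
          Y≤YP = ≤-trans (≤-reflexive (sym (*-identityʳ Y))) (*-monoʳ-≤ Y (bases-head≥1 large))

  split-value : ∀ {k g′} → Bases≥2 3 (suc (suc k)) → ClosedAt k g′ → ∀ M t g → t ≤ M →
    g ≡ qProd (suc k) * uSum (suc k) (M ∸ t) (reach k M) →
    p (4 + k) * g + q (4 + k) * g′ t ≡ qProd (suc k) * splitSum k M t (window k M)
  split-value {k} {g′} large closed M t g t≤M g≡ = begin
      p (4 + k) * g + q (4 + k) * g′ t
    ≡⟨ cong₂ (λ a b → p (4 + k) * a + q (4 + k) * b) g≡ (closed t W (≤-trans t≤M (window-covers large M))) ⟩
      p (4 + k) * (q (4 + k) * qProd k * uSum (suc k) (M ∸ t) Z) + q (4 + k) * (qProd k * uSum k t W)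
    ≡⟨ factor (p (4 + k)) (q (4 + k)) (qProd k) _ _ ⟩
      q (4 + k) * qProd k * (p (4 + k) * uSum (suc k) (M ∸ t) Z + uSum k t W)
    ≡⟨ cong (qProd (suc k) *_) (splitSum-blocks large M t Z) ⟩
      qProd (suc k) * splitSum k M t W
    ∎ where
      open ≡-Reasoning
      Z W : ℕ
      Z = reach k M
      W = window k M
      factor : ∀ P a b s s′ → P * (a * b * s) + a * (b * s′) ≡ a * b * (P * s + s′)
      factor = solve-∀

  -- Induction step: if G_{3+k} has the closed form, so does G_{4+k}.  Every split gives
  -- at least the closed value (splitSum-≥), and a balanced split attains it.
  Gk-closed : ∀ {k} → Bases≥2 3 (suc (suc k)) → ClosedAt k (G p q (3 + k)) →
    ∀ fuel n → n ≤ fuel → ∀ Y → n ≤ N (suc k) Y →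
    Gk p q (4 + k) (G p q (3 + k)) fuel n ≡ qProd (suc k) * uSum (suc k) n Y
  Gk-closed {k} large closed fuel zero _ Y _ =
    sym (trans (cong (qProd (suc k) *_) (uSum-zero (suc k) Y)) (*-zeroʳ (qProd (suc k))))
  Gk-closed {k} large closed (suc fuel) (suc n) (s≤s n≤fuel) Y M≤N =
    trans (minOver-unique n candidate (qProd (suc k) * uSum (suc k) M W) closed-≤ closed-attained)
          (cong (qProd (suc k) *_) (uSum-stable {Y₁ = W} {Y₂ = Y} large (window-covers-next large M) M≤N))
    where
    M W : ℕ
    M = suc n
    W = window k M
    candidate : ℕ → ℕ
    candidate t = p (4 + k) * Gk p q (4 + k) (G p q (3 + k)) fuel (M ∸ t) + q (4 + k) * G p q (3 + k) t

    remainder≤fuel : ∀ t → 1 ≤ t → M ∸ t ≤ fuel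
    remainder≤fuel (suc t) _ = ≤-trans (m∸n≤m n t) n≤fuel

    value : ∀ t → 1 ≤ t → t ≤ M → candidate t ≡ qProd (suc k) * splitSum k M t W
    value t 1≤t t≤M = split-value large closed M t _ t≤M
      (Gk-closed large closed fuel (M ∸ t) (remainder≤fuel t 1≤t) (reach k M)
                 (≤-trans (m∸n≤m M t) (reach-covers-next large M)))

    closed-≤ : ∀ t → 1 ≤ t → t ≤ M → qProd (suc k) * uSum (suc k) M W ≤ candidate t
    closed-≤ t 1≤t t≤M = ≤-trans (*-monoʳ-≤ (qProd (suc k)) (splitSum-≥ {k} {M} {t} W large t≤M))
                                 (≤-reflexive (sym (value t 1≤t t≤M)))

    closed-attained : ∃ λ t → 1 ≤ t × t ≤ M × candidate t ≡ qProd (suc k) * uSum (suc k) M W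
    closed-attained =
      let (t , 1≤t , t≤M , balanced) =
            balanced-split-exists {k} {M} W large (s≤s z≤n) (window-covers-next large M)
      in  t , 1≤t , t≤M ,
          trans (value t 1≤t t≤M) (cong (qProd (suc k) *_) (splitSum-balanced {k} {M} {t} W large t≤M balanced))

  G-closed : ∀ k → Bases≥2 3 (suc k) → ClosedAt k (G p q (3 + k))
  G-closed zero    large = G3-closed large
  G-closed (suc k) large n = Gk-closed large (G-closed k (bases-init large)) n n ≤-refl

  -- Let w₁ = u_j and w₂ = u_{j+1} (in u^{3+k}).  If n - j lies between the numbers of
  -- terms of u^{4+k} involving p_{4+k} below w₁ and below w₂, the split n = (n - j) + j
  -- is balanced at every sample y: below w₁ both parts are covered, from w₂ on both are
  -- exhausted, and in between N k y = j.
  balanced-between : ∀ {k j n w₁ w₂} → Bases≥2 3 (suc (suc k)) → IsNth k j w₁ → IsNth k (suc j) w₂ →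
    N₊ (suc k) (pred w₁) ≤ n ∸ j → n ∸ j ≤ N₊ (suc k) (pred w₂) → ∀ y → Balanced k n j y
  balanced-between {k} {j} {n} {w₁} {w₂} large (nth lo₁ hi₁) (nth lo₂ hi₂) covered exhausted y
    with y ≤? pred w₁ | w₂ ≤? y
  ... | yes y≤w₁-1 | _ =
    both-covered (≤-trans (N₊-mono large y≤w₁-1) covered)
                 (≤-trans (N-mono (bases-init large) y≤w₁-1) (<⇒≤ lo₁))
  ... | no _ | yes w₂≤y =
    both-exhausted (≤-trans exhausted (N₊-mono large (≤-trans pred[n]≤n w₂≤y)))
                   (≤-trans (n≤1+n j) (≤-trans hi₂ (N-mono (bases-init large) w₂≤y)))
  ... | no y≰w₁-1 | no w₂≰y = balanced-tie {k} {n} {j} {y} (≤-antisym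
    (s≤s⁻¹ (≤-<-trans (N-mono (bases-init large) (<⇒≤pred (≰⇒> w₂≰y))) lo₂))
    (≤-trans hi₁ (N-mono (bases-init large) (pred<⇒≤ w₁ (≰⇒> y≰w₁-1)))))
    where
    pred<⇒≤ : ∀ w → pred w < y → w ≤ y
    pred<⇒≤ zero    _ = z≤n
    pred<⇒≤ (suc w) h = h

  interval-balanced : ∀ {k j kj kj₁ n} → Bases≥2 3 (suc (suc k)) →
    KIndex k j kj → KIndex k (suc j) kj₁ → kj ≤ n → n < kj₁ → ∀ y → Balanced k n j y
  interval-balanced {k} {j} {n = n} large (w₁ , nth₁ , kj≡) (w₂ , nth₂ , kj₁≡) kj≤n n<kj₁ =
    balanced-between large nth₁ nth₂
      (m+n≤o⇒m≤o∸n _ (subst (_≤ n) (trans kj≡ (+-comm j _)) kj≤n))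
      (m≤n+o⇒m∸n≤o n j (s≤s⁻¹ (subst (suc n ≤_) kj₁≡ n<kj₁)))

-- By the closed form,
-- G_k(n) = q_3⋯q_k · uSum; for k_j ≤ n < k_{j+1} the split n = (n - j) + j is balanced, so
-- this equals q_3⋯q_k · splitSum, which split-value identifies with the right-hand side.
corollary1 : (k : ℕ) → 4 ≤ k → (p q : ℕ → ℕ) →
    (∀ i → 3 ≤ i → 1 ≤ p i) → (∀ i → 3 ≤ i → 1 ≤ q i) →
    (∀ i → 3 ≤ i → i ≤ k → 2 ≤ p i) →
    (j : ℕ) → 1 ≤ j → (kj kj1 : ℕ) → IsK p k j kj → IsK p k (suc j) kj1 →
    (n : ℕ) → kj ≤ n → n < kj1 →
    G p q k n ≡ p k * G p q k (n ∸ j) + q k * G p q (k ∸ 1) j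
corollary1 (suc (suc (suc (suc k)))) (s≤s (s≤s (s≤s (s≤s _)))) p q _ _ p≥2
           j _ kj kj1 isKʲ isKʲ⁺¹ n kj≤n n<kj1 = begin
    G p q (4 + k) n
  ≡⟨ G-closed (suc k) large n W (window-covers-next large n) ⟩
    qProd (suc k) * uSum (suc k) n W
  ≡⟨ cong (qProd (suc k) *_) (sym (splitSum-balanced W large j≤n (λ y _ → balanced y))) ⟩
    qProd (suc k) * splitSum k n j W
  ≡⟨ sym (split-value large (G-closed k (bases-init large)) n j _ j≤n
            (G-closed (suc k) large (n ∸ j) (reach k n) (≤-trans (m∸n≤m n j) (reach-covers-next large n)))) ⟩
    p (4 + k) * G p q (4 + k) (n ∸ j) + q (4 + k) * G p q (3 + k) j
  ∎ where
  open ≡-Reasoning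
  open ClosedForm p q
  large : Bases≥2 3 (suc (suc k))
  large r r<k+2 = p≥2 (3 + r) (m≤m+n 3 r) (s≤s (s≤s (s≤s (s≤s⁻¹ r<k+2))))
  W : ℕ
  W = window k n
  kj-index : KIndex k j kj
  kj-index = IsK⇒KIndex large isKʲ
  j≤n : j ≤ n
  j≤n = ≤-trans (KIndex⇒≥ kj-index) kj≤n
  balanced : ∀ y → Balanced k n j y
  balanced = interval-balanced large kj-index (IsK⇒KIndex large isKʲ⁺¹) kj≤n n<kj1
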